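{- In the generalized Zeckendorf game with $p=4$ players on any $n\ge 16$, no player has a winning strategy.
   Context: Let $a_1=1$, $a_2=2$ and $a_{i+1}=i\,a_i+a_{i-1}$ for $i\ge 2$. The generalized Zeckendorf game on $n$: the state is a multiset of terms of the sequence, initially $n$ copies of $a_1=1$. A move is one of: (combining) replace two $1$'s by one $2$; or, for $i\ge 2$, if the multiset contains at least $i$ copies of $a_i$ and at least one $a_{i-1}$, replace $i$ copies of $a_i$ and one $a_{i-1}$ by one $a_{i+1}$; (splitting) if it contains three $2$'s, replace them by one $1$ and one $5$; or, for $i\ge 3$, if it contains $i+1$ copies of $a_i$, replace them by one $a_{i+1}$, $i-2$ copies of $a_{i-1}$ and one $a_{i-2}$. Players $1,2,\dots,p$ move in cyclic order (player 1 first) until no move is available; the player making the last move wins. A player has a winning strategy if that player can guarantee making the last move regardless of the moves of all other players. -}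

module Defs where

open import Data.Nat using (ℕ; zero; suc; _+_; _*_; _∸_; _≤_; _<_; pred; NonZero)
open import Data.Nat.DivMod using (_%_)
open import Data.List using (List; []; _∷_)
open import Data.Sum using (_⊎_)
open import Data.Product using (_×_)
open import Relation.Nullary using (¬_)
open import Relation.Binary.PropositionalEquality using (_≡_; _≢_)

-- The sequence a_1 = 1, a_2 = 2, a_{i+1} = i a_i + a_{i-1}  (i ≥ 2).
-- aPair i = (a_{i+1}, a_{i+2}).
private
  aPair : ℕ → ℕ × ℕ
  aPair zero = 1 Data.Product., 2
  aPair (suc i) with aPair i
  ... | x Data.Product., y = y Data.Product., (suc (suc i) * y + x)

-- a i = a_i for i ≥ 1 (a 0 is a dummy value).
a : ℕ → ℕ
a zero = 0
a (suc i) = Data.Product.proj₁ (aPair i)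

-- A game state is a multiset of terms of the sequence. Since the terms
-- a_1 < a_2 < a_3 < ... are pairwise distinct, such a multiset is given by
-- the multiplicities: position j of the list (0-based) holds the number of
-- copies of a_{j+1}; missing positions mean multiplicity 0.
State : Set
State = List ℕ

get : State → ℕ → ℕ
get [] _ = 0
get (x ∷ xs) zero = x
get (x ∷ xs) (suc j) = get xs j

upd : State → ℕ → (ℕ → ℕ) → State
upd [] zero f = f 0 ∷ []
upd [] (suc j) f = 0 ∷ upd [] j f
upd (x ∷ xs) zero f = f x ∷ xs
upd (x ∷ xs) (suc j) f = x ∷ upd xs j f

cnt : State → ℕ → ℕ
cnt s i = get s (pred i)

add : State → ℕ → ℕ → State
add s i c = upd s (pred i) (λ x → x + c)

sub : State → ℕ → ℕ → State
sub s i c = upd s (pred i) (λ x → x ∸ c)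

data Move : State → State → Set where
  comb1  : ∀ {s} → 2 ≤ cnt s 1 →
           Move s (add (sub s 1 2) 2 1)
  combi  : ∀ {s} i → 2 ≤ i → i ≤ cnt s i → 1 ≤ cnt s (i ∸ 1) →
           Move s (add (sub (sub s i i) (i ∸ 1) 1) (suc i) 1)
  split2 : ∀ {s} → 3 ≤ cnt s 2 →
           Move s (add (add (sub s 2 3) 1 1) 3 1)
  spliti : ∀ {s} i → 3 ≤ i → suc i ≤ cnt s i →
           Move s (add (add (add (sub s i (suc i)) (suc i) 1) (i ∸ 1) (i ∸ 2)) (i ∸ 2) 1)

Terminal : State → Set
Terminal s = ∀ {s'} → ¬ Move s s'

-- Wins p k s t : with p players, in state s after t moves have been made
-- (so the player to move is the one with residue t % p; residue k stands for
-- player k+1), player k+1 can guarantee to make the last move regardless of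
-- the moves of all other players.
data Wins (p : ℕ) .{{_ : NonZero p}} (k : ℕ) : State → ℕ → Set where
  mine   : ∀ {s t s'} → t % p ≡ k → Move s s' →
           (Terminal s' ⊎ Wins p k s' (suc t)) → Wins p k s t
  theirs : ∀ {s t} → t % p ≢ k → ¬ Terminal s →
           (∀ {s'} → Move s s' → (¬ Terminal s') × Wins p k s' (suc t)) →
           Wins p k s t

initial : ℕ → State
initial n = n ∷ []

HasWinningStrategy : (p : ℕ) .{{_ : NonZero p}} → ℕ → ℕ → Set
HasWinningStrategy p k n = Wins p k (initial n) 0

{-# OPTIONS --safe #-}
module Submission where

open import Defs
open import Data.Empty using (⊥-elim)
open import Data.List using ([]; _∷_; length)
open import Data.Nat using (ℕ; zero; suc; _+_; _≤_; _<_; z≤n; s≤s; NonZero; _≟_)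
open import Data.Nat.DivMod using (_%_; [m+n]%n≡m%n; %-distribˡ-+)
open import Data.Nat.Properties using (+-suc; +-comm; m+n∸n≡m; m≤m+n; m≤n+m; m≤n⇒∃[o]m+o≡n; ≤-trans; ≤⇒≯; <⇒≤)
open import Data.Product using (_×_; _,_; ∃; proj₁; proj₂)
open import Data.Sum using (_⊎_; inj₁; inj₂)
open import Function using (_∘_)
open import Relation.Nullary using (¬_)
open import Relation.Nullary.Decidable using (decidable-stable)
open import Relation.Binary.PropositionalEquality
  using (_≡_; _≢_; refl; sym; trans; cong; cong₂; subst; module ≡-Reasoning)

-- Proof idea: if a state holds two 1's and two 2's, then 1 + 2 + 2 → 5 in one move, and
-- 1 + 1 → 2 followed by 2 + 2 + 2 → 1 + 5 in two moves, reach the same state. A player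
-- can win from a given state only at times of a single residue mod p, so a player loses
-- as soon as the opponents can make both of these moves. From n ≥ 16 ones, the opponents
-- of each of the four players steer the game into such a position; the player's own moves
-- on the way are forced, except for player 3 at time 2, whose two options both lose.

private
  variable
    k t t′ x y : ℕ
    s s′ u u′ v rest : State

%-suc-injective : ∀ {p} .{{_ : NonZero p}} {m n} → suc m % p ≡ suc n % p → m % p ≡ n % p
%-suc-injective {suc q} {m} {n} eq = begin
  m % suc q                            ≡⟨ via-suc m ⟩
  (suc m % suc q + q % suc q) % suc q  ≡⟨ cong (λ r → (r + q % suc q) % suc q) eq ⟩
  (suc n % suc q + q % suc q) % suc q  ≡⟨ sym (via-suc n) ⟩
  n % suc q                            ∎
  where
  open ≡-Reasoning
  via-suc : ∀ m → m % suc q ≡ (suc m % suc q + q % suc q) % suc q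
  via-suc m = begin
    m % suc q                            ≡⟨ sym ([m+n]%n≡m%n m (suc q)) ⟩
    (m + suc q) % suc q                  ≡⟨ cong (_% suc q) (+-suc m q) ⟩
    (suc m + q) % suc q                  ≡⟨ %-distribˡ-+ (suc m) q (suc q) ⟩
    (suc m % suc q + q % suc q) % suc q  ∎

consecutive-%-distinct : ∀ {p} .{{_ : NonZero p}} → 2 ≤ p → ∀ t → t % p ≢ suc t % p
consecutive-%-distinct (s≤s (s≤s _)) zero    = λ ()
consecutive-%-distinct 2≤p           (suc t) =
  consecutive-%-distinct 2≤p t ∘ %-suc-injective {m = t} {n = suc t}

-- Two winning strategies for the same player from the same state are played against each
-- other: at every step at most one of them is to move, so the play is well defined, and
-- its last move would have to be made by player k at two different times mod p.
wins-residue-unique : ∀ {p} .{{_ : NonZero p}} →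
                      Wins p k s t → Wins p k s t′ → t % p ≡ t′ % p
wins-residue-unique {t = t} {t′} {p} w w′ =
  decidable-stable (t % p ≟ t′ % p) (λ ne → clash ne w w′)
  where
  clash : ∀ {p} .{{_ : NonZero p}} {k s t t′} →
          t % p ≢ t′ % p → Wins p k s t → ¬ Wins p k s t′
  clash ne (mine turn _ _) (mine turn′ _ _) = ne (trans turn (sym turn′))
  clash ne (mine _ mv (inj₁ end)) (theirs _ _ f) = proj₁ (f mv) end
  clash ne (mine _ mv (inj₂ w)) (theirs _ _ f) = clash (ne ∘ %-suc-injective) w (proj₂ (f mv))
  clash ne (theirs _ _ f) (mine _ mv (inj₁ end)) = proj₁ (f mv) end
  clash ne (theirs _ _ f) (mine _ mv (inj₂ w′)) = clash (ne ∘ %-suc-injective) (proj₂ (f mv)) w′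
  clash ne (theirs _ live f) (theirs _ _ f′) =
    live λ mv → clash (ne ∘ %-suc-injective) (proj₂ (f mv)) (proj₂ (f′ mv))

wins-after-others-move : ∀ {p} .{{_ : NonZero p}} →
                         t % p ≢ k → Move s s′ → Wins p k s t → Wins p k s′ (suc t)
wins-after-others-move ¬turn _  (mine turn _ _) = ⊥-elim (¬turn turn)
wins-after-others-move _     mv (theirs _ _ f)  = proj₂ (f mv)

¬wins-before-transposition : ∀ {p} .{{_ : NonZero p}} → 2 ≤ p → t % p ≢ k → suc t % p ≢ k →
                             Move s u → Move s v → Move v u → ¬ Wins p k s t
¬wins-before-transposition {t = t} {k = k} {u = u} {p = p} 2≤p ¬turn₀ ¬turn₁ s→u s→v v→u w =
  consecutive-%-distinct 2≤p (suc t) (wins-residue-unique directly via-v)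
  where
  directly : Wins p k u (suc t)
  directly = wins-after-others-move ¬turn₀ s→u w
  via-v : Wins p k u (suc (suc t))
  via-v = wins-after-others-move ¬turn₁ v→u (wins-after-others-move ¬turn₀ s→v w)

combine₁ combine₂ split₂ : State → State
combine₁ s = add (sub s 1 2) 2 1
combine₂ s = add (sub (sub s 2 2) 1 1) 3 1
split₂   s = add (add (sub s 2 3) 1 1) 3 1

combine₁-move : Move (suc (suc x) ∷ rest) (combine₁ (suc (suc x) ∷ rest))
combine₁-move = comb1 (s≤s (s≤s z≤n))

combine₂-move : Move (suc x ∷ suc (suc y) ∷ rest) (combine₂ (suc x ∷ suc (suc y) ∷ rest))
combine₂-move = combi 2 (s≤s (s≤s z≤n)) (s≤s (s≤s z≤n)) (s≤s z≤n)

split₂∘combine₁≡combine₂ : ∀ x y rest → let s = suc (suc x) ∷ suc (suc y) ∷ rest in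
                           split₂ (combine₁ s) ≡ combine₂ s
split₂∘combine₁≡combine₂ x y rest =
  cong₂ (λ a b → a ∷ b ∷ upd rest 0 (_+ 1)) (+-comm x 1) (m+n∸n≡m y 1)

¬wins-with-two-ones-and-two-twos : ∀ {p} .{{_ : NonZero p}} → 2 ≤ p →
                                   t % p ≢ k → suc t % p ≢ k →
                                   ¬ Wins p k (suc (suc x) ∷ suc (suc y) ∷ rest) t
¬wins-with-two-ones-and-two-twos {x = x} {y} {rest} 2≤p ¬turn₀ ¬turn₁ =
  ¬wins-before-transposition 2≤p ¬turn₀ ¬turn₁ combine₂-move combine₁-move
    (subst (Move _) (split₂∘combine₁≡combine₂ x y rest) (split2 (s≤s (s≤s (m≤n+m 1 y)))))

get-beyond-length : ∀ s {j} → length s ≤ j → get s j ≡ 0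
get-beyond-length []       _       = refl
get-beyond-length (_ ∷ xs) {suc j} (s≤s ℓ) = get-beyond-length xs ℓ

cnt-beyond-a₃ : length s ≤ 3 → ∀ i → cnt s (4 + i) ≡ 0
cnt-beyond-a₃ {s} ℓ i = get-beyond-length s (≤-trans ℓ (m≤m+n 3 i))

moves-of-small-state : length s ≤ 3 → cnt s 2 ≤ 2 → cnt s 3 ≤ 2 → Move s s′ →
                       s′ ≡ combine₁ s ⊎ (2 ≤ cnt s 2 × s′ ≡ combine₂ s)
moves-of-small-state _ _ _ (comb1 _) = inj₁ refl
moves-of-small-state _ _ _ (combi 2 _ enough _) = inj₂ (enough , refl)
moves-of-small-state _ _ fives≤2 (combi 3 _ three≤fives _) = ⊥-elim (≤⇒≯ fives≤2 three≤fives)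
moves-of-small-state _ _ _ (combi 1 (s≤s ()) _ _)
moves-of-small-state {s = s} ℓ _ _ (combi (suc (suc (suc (suc i)))) _ enough _)
  with () ← subst (4 + i ≤_) (cnt-beyond-a₃ {s} ℓ i) enough
moves-of-small-state _ twos≤2 _ (split2 three≤twos) = ⊥-elim (≤⇒≯ twos≤2 three≤twos)
moves-of-small-state _ _ fives≤2 (spliti 3 _ four≤fives) = ⊥-elim (≤⇒≯ fives≤2 (<⇒≤ four≤fives))
moves-of-small-state _ _ _ (spliti 1 (s≤s ()) _)
moves-of-small-state _ _ _ (spliti 2 (s≤s (s≤s ())) _)
moves-of-small-state {s = s} ℓ _ _ (spliti (suc (suc (suc (suc i)))) _ enough)
  with () ← subst (5 + i ≤_) (cnt-beyond-a₃ {s} ℓ i) enough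

resolve-nonterminal : ∀ {p} .{{_ : NonZero p}} →
                      Move u u′ → Terminal u ⊎ Wins p k u t → Wins p k u t
resolve-nonterminal mv (inj₁ end) = ⊥-elim (end mv)
resolve-nonterminal _  (inj₂ w)   = w

-- The four 1's make sure that neither successor state is terminal.
wins-after-own-move-in-small-state :
  ∀ {p} .{{_ : NonZero p}} → let s = suc (suc (suc (suc x))) ∷ rest in
  t % p ≡ k → length s ≤ 3 → cnt s 2 ≤ 2 → cnt s 3 ≤ 2 → Wins p k s t →
  Wins p k (combine₁ s) (suc t) ⊎ (2 ≤ cnt s 2 × Wins p k (combine₂ s) (suc t))
wins-after-own-move-in-small-state turn _ _ _ (theirs ¬turn _ _) = ⊥-elim (¬turn turn)
wins-after-own-move-in-small-state _ ℓ twos≤2 fives≤2 (mine _ mv next)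
  with moves-of-small-state ℓ twos≤2 fives≤2 mv
... | inj₁ refl            = inj₁ (resolve-nonterminal combine₁-move next)
... | inj₂ (enough , refl) = inj₂ (enough , resolve-nonterminal combine₁-move next)

wins-after-forced-combine₁ :
  ∀ {p} .{{_ : NonZero p}} → let s = suc (suc (suc (suc x))) ∷ rest in
  t % p ≡ k → length s ≤ 3 → cnt s 2 ≤ 1 → cnt s 3 ≤ 2 → Wins p k s t →
  Wins p k (combine₁ s) (suc t)
wins-after-forced-combine₁ turn ℓ twos≤1 fives≤2 w
  with wins-after-own-move-in-small-state turn ℓ (≤-trans twos≤1 (s≤s z≤n)) fives≤2 w
... | inj₁ w′            = w′
... | inj₂ (two≤twos , _) = ⊥-elim (≤⇒≯ twos≤1 two≤twos)

module _ {m : ℕ} where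
  private
    2≤4 : 2 ≤ 4
    2≤4 = s≤s (s≤s z≤n)

    others-combine₁ : t % 4 ≢ k → Wins 4 k (suc (suc x) ∷ rest) t →
                      Wins 4 k (combine₁ (suc (suc x) ∷ rest)) (suc t)
    others-combine₁ ¬turn = wins-after-others-move ¬turn combine₁-move

    others-combine₂ : t % 4 ≢ k → Wins 4 k (suc x ∷ suc (suc y) ∷ rest) t →
                      Wins 4 k (combine₂ (suc x ∷ suc (suc y) ∷ rest)) (suc t)
    others-combine₂ ¬turn = wins-after-others-move ¬turn combine₂-move

  player₁-loses : ¬ Wins 4 0 ((16 + m) ∷ []) 0
  player₁-loses w =
    ¬wins-with-two-ones-and-two-twos 2≤4 (λ ()) (λ ())
      (others-combine₁ (λ ()) (wins-after-forced-combine₁ refl (s≤s z≤n) z≤n z≤n w))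

  player₂-loses : ¬ Wins 4 1 ((16 + m) ∷ []) 0
  player₂-loses w =
    ¬wins-with-two-ones-and-two-twos 2≤4 (λ ()) (λ ())
      (wins-after-forced-combine₁ refl (s≤s (s≤s z≤n)) (s≤s z≤n) z≤n
        (others-combine₁ (λ ()) w))

  player₃-loses : ¬ Wins 4 2 ((16 + m) ∷ []) 0
  player₃-loses w
    with wins-after-own-move-in-small-state refl (s≤s (s≤s z≤n)) (s≤s (s≤s z≤n)) z≤n w₂
    where
    w₂ : Wins 4 2 ((12 + m) ∷ 2 ∷ []) 2
    w₂ = others-combine₁ (λ ()) (others-combine₁ (λ ()) w)
  ... | inj₁ w₃ = ¬wins-with-two-ones-and-two-twos 2≤4 (λ ()) (λ ()) w₃
  ... | inj₂ (_ , w₃) = ¬wins-with-two-ones-and-two-twos 2≤4 (λ ()) (λ ()) w₈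
    where
    w₆ : Wins 4 2 ((6 + m) ∷ 0 ∷ 2 ∷ []) 6
    w₆ = others-combine₂ (λ ()) (others-combine₁ (λ ()) (others-combine₁ (λ ()) w₃))
    w₈ : Wins 4 2 ((2 + m) ∷ 2 ∷ 2 ∷ []) 8
    w₈ = others-combine₁ (λ ())
           (wins-after-forced-combine₁ refl (s≤s (s≤s (s≤s z≤n))) z≤n (s≤s (s≤s z≤n)) w₆)

  player₄-loses : ¬ Wins 4 3 ((16 + m) ∷ []) 0
  player₄-loses w = ¬wins-with-two-ones-and-two-twos 2≤4 (λ ()) (λ ()) w₅
    where
    w₃ : Wins 4 3 ((11 + m) ∷ 0 ∷ 1 ∷ []) 3
    w₃ = others-combine₂ (λ ()) (others-combine₁ (λ ()) (others-combine₁ (λ ()) w))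
    w₅ : Wins 4 3 ((7 + m) ∷ 2 ∷ 1 ∷ []) 5
    w₅ = others-combine₁ (λ ())
           (wins-after-forced-combine₁ refl (s≤s (s≤s (s≤s z≤n))) z≤n (s≤s z≤n) w₃)

player-loses : ∀ m k → k < 4 → ¬ HasWinningStrategy 4 k (16 + m)
player-loses _ 0 _ = player₁-loses
player-loses _ 1 _ = player₂-loses
player-loses _ 2 _ = player₃-loses
player-loses _ 3 _ = player₄-loses
player-loses _ (suc (suc (suc (suc _)))) (s≤s (s≤s (s≤s (s≤s ()))))

lemma7p6 : (n : ℕ) → 16 ≤ n → (k : ℕ) → k < 4 → ¬ HasWinningStrategy 4 k n
lemma7p6 n 16≤n k k<4 =
  subst (λ n → ¬ HasWinningStrategy 4 k n) (proj₂ split) (player-loses (proj₁ split) k k<4)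
  where
  split : ∃ λ m → 16 + m ≡ n
  split = m≤n⇒∃[o]m+o≡n 16≤n
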